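{- Let $\mathbf x\in\mathbf K$ and let $\eta\in M_{\mathbf x}$ be such that $|\mathscr A^{\mathbf x}_\eta|=1$, i.e. $\mathscr A^{\mathbf x}_\eta=\{\{\eta\}\}$. Then there is $\mathbf y\in\mathbf K$ such that $\mathbf x\le_{\mathbf K}\mathbf y$, $|\mathscr A^{\mathbf y}_\eta|>1$ and $\|\mathbf y\|\le\|\mathbf x\|+\aleph_0$.
   Context: Let $(M,<_M)$ be a partial order. For $\eta\in M$ let $M_{\ge\eta}=\{\nu\in M:\eta\le_M\nu\}$ and $M_{\le\eta}=\{\nu:\nu\le_M\eta\}$. Two elements are compatible if they have a common $\le_M$-upper bound and incompatible otherwise. For $B\subseteq M$: $\max(B)$ is the set of $\le_M$-maximal elements of $B$; $B_{\ge\eta}=B\cap M_{\ge\eta}$; ${\rm suc}_B(\nu)=\{\rho\in B:\nu<_M\rho$ and there is no $\rho'\in B$ with $\nu<_M\rho'<_M\rho\}$. ${\rm CWT}(M)$ is the set of $B\subseteq M$ such that: (a) $B$ is countable; (b) $B$ has a least element ${\rm rt}(B)$; (c) $(B,<_M)$ is a tree all of whose chains are finite; (d) for each $\nu\in B$, ${\rm suc}_B(\nu)$ is empty or infinite; (e) $<_M$-incomparable elements of $B$ are incompatible in $M$; (f) if $\nu\in B\setminus\max(B)$ and $F\subseteq M\setminus M_{\le\nu}$ is finite, then infinitely many $\varrho\in{\rm suc}_B(\nu)$ are incompatible with every member of $F$. A front of $B\in{\rm CWT}(M)$ is a set $Y\subseteq B$ of pairwise $\le_M$-incomparable elements meeting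 every maximal chain of $B$. ${\rm sb}(B)$ is the set of $B'\in{\rm CWT}(M)$ with $B'\subseteq B$, ${\rm rt}(B')={\rm rt}(B)$, and for every $\nu\in B'$: ${\rm suc}_{B'}(\nu)\subseteq{\rm suc}_B(\nu)$ and ${\rm suc}_B(\nu)\setminus{\rm suc}_{B'}(\nu)$ is finite. An almost front of $B$ is a set $Y\subseteq M$ of pairwise incomparable elements such that $Y\cap B'$ is a front of $B'$ for some $B'\in{\rm sb}(B)$. ${\rm psb}(B)$ is the set of $B'\in{\rm CWT}(M)$ with $B'\subseteq B$, ${\rm rt}(B')={\rm rt}(B)$, and ${\rm suc}_{B'}(\nu)$ an infinite subset of ${\rm suc}_B(\nu)$ for every $\nu\in B'\setminus\max(B)$. For $B_1,B_2\in{\rm CWT}(M)$, $B_1\le^*_M B_2$ means: ${\rm rt}(B_1)={\rm rt}(B_2)$ and there is $B_2'\in{\rm sb}(B_2)$ with $B_2'\cap B_1\in{\rm psb}(B_1)$ and every almost front of $B_2'\cap B_1$ an almost front of $B_2$. $\mathbf K$ is the class of $\mathbf x=(M_{\mathbf x},<_{M_{\mathbf x}},\langle\mathscr A^{\mathbf x}_\eta:\eta\in M_{\mathbf x}\rangle,\mathscr A_{\mathbf x},\mathscr B_{\mathbf x},\le_{\mathbf x})$ such that: $M=M_{\mathbf x}$ is a partial order with least element ${\rm rt}_{\mathbf x}$; each $\mathscr A^{\mathbf x}_\eta\subseteq{\rm CWT}(M)$, every $B\in\mathscr A^{\mathbf x}_\eta$ has ${\rm rt}(B)=\eta$, and $\{\eta\}\in\mathscr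 A^{\mathbf x}_\eta$; $\mathscr A_{\mathbf x}=\bigcup\{\mathscr A^{\mathbf x}_\eta:\eta\in M\setminus\{{\rm rt}_{\mathbf x}\}\}$; $\mathscr B_{\mathbf x}=\mathscr A^{\mathbf x}_{{\rm rt}_{\mathbf x}}\setminus\{\{{\rm rt}_{\mathbf x}\}\}$ and $\le_{\mathbf x}$ is a directed partial order on $\mathscr B_{\mathbf x}$ such that $B_1\le_{\mathbf x}B_2$ implies $B_1\le^*_M B_2$; and if $\nu\in B\in\mathscr A^{\mathbf x}_\eta$ then $B\cap M_{\ge\nu}\in\mathscr A^{\mathbf x}_\nu$. Let $\|\mathbf x\|=|M_{\mathbf x}|+\sum_{\eta\in M_{\mathbf x}}|\mathscr A^{\mathbf x}_\eta|$. $\mathbf x\le_{\mathbf K}\mathbf y$ means: $M_{\mathbf x}$ is a suborder of $M_{\mathbf y}$ and for $\eta,\nu\in M_{\mathbf x}$, $\eta,\nu$ are incompatible in $M_{\mathbf x}$ iff they are incompatible in $M_{\mathbf y}$; $\mathscr A^{\mathbf x}_\eta\subseteq\mathscr A^{\mathbf y}_\eta$ for $\eta\in M_{\mathbf x}$; ${\rm rt}_{\mathbf y}={\rm rt}_{\mathbf x}$; and $\le_{\mathbf x}$ equals the restriction of $\le_{\mathbf y}$ to $\mathscr B_{\mathbf x}$. -}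

module Defs where

open import Level using (0ℓ) renaming (suc to lsuc)
open import Data.Nat using (ℕ)
open import Data.Empty using (⊥)
open import Data.Product using (Σ; ∃; ∃-syntax; _×_; _,_; proj₁; proj₂)
open import Data.Sum using (_⊎_; inj₁; inj₂)
open import Data.List using (List)
open import Data.List.Membership.Propositional using (_∈_)
open import Data.List.Relation.Unary.All using (All)
open import Relation.Nullary using (¬_)
open import Relation.Unary using (_⊆_; _≐_; _∩_)
open import Relation.Binary.PropositionalEquality using (_≡_; _≢_)
open import Relation.Binary.Structures using (IsPartialOrder)
open import Function.Bundles using (_⇔_)

-- Subsets of a carrier M are predicates M → Set; two subsets are the same
-- set iff they are extensionally equal (_≐_).
Subset : Set → Set₁
Subset M = M → Set

｛_｝ : {M : Set} → M → Subset M
｛ η ｝ = λ ν → ν ≡ η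

Img : {M N : Set} → (M → N) → Subset M → Subset N
Img f B ν = ∃[ a ] (B a × f a ≡ ν)

module Order {M : Set} (_≤_ : M → M → Set) where

  _<_ : M → M → Set
  a < b = a ≤ b × a ≢ b

  M≥ : M → Subset M
  M≥ η ν = η ≤ ν

  M≤ : M → Subset M
  M≤ η ν = ν ≤ η

  Compatible : M → M → Set
  Compatible a b = ∃[ c ] (a ≤ c × b ≤ c)

  Incompatible : M → M → Set
  Incompatible a b = ¬ Compatible a b

  Finite : Subset M → Set
  Finite B = Σ (List M) λ xs → (∀ x → B x → x ∈ xs)

  Infinite : Subset M → Set
  Infinite B = ¬ Finite B

  Countable : Subset M → Set
  Countable B = Σ (Σ M B → ℕ) (λ f → ∀ (p q : Σ M B) → f p ≡ f q → proj₁ p ≡ proj₁ q)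

  IsLeast : Subset M → M → Set
  IsLeast B r = B r × (∀ x → B x → r ≤ x)

  IsChain : Subset M → Set
  IsChain C = ∀ a b → C a → C b → (a ≤ b ⊎ b ≤ a)

  IsTree : Subset M → Set
  IsTree B = ∀ x y z → B x → B y → B z → y ≤ x → z ≤ x → (y ≤ z ⊎ z ≤ y)

  ChainsFinite : Subset M → Set₁
  ChainsFinite B = ∀ (C : Subset M) → C ⊆ B → IsChain C → Finite C

  Suc : Subset M → M → Subset M
  Suc B ν ρ = B ρ × ν < ρ × ¬ (∃[ ρ' ] (B ρ' × ν < ρ' × ρ' < ρ))

  IsMax : Subset M → M → Set
  IsMax B ν = B ν × (∀ ρ → B ρ → ν ≤ ρ → ρ ≡ ν)

  record CWT (B : Subset M) : Set₁ where
    field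
      countable    : Countable B
      hasRoot      : ∃[ r ] IsLeast B r
      tree         : IsTree B
      chainsFinite : ChainsFinite B
      sucEmptyOrInfinite : ∀ ν → B ν → (∀ ρ → ¬ Suc B ν ρ) ⊎ Infinite (Suc B ν)
      incomparable⇒incompatible :
        ∀ a b → B a → B b → ¬ (a ≤ b) → ¬ (b ≤ a) → Incompatible a b
      branching : ∀ ν → B ν → ¬ IsMax B ν → (F : List M) →
        All (λ μ → ¬ (μ ≤ ν)) F →
        Infinite (λ ρ → Suc B ν ρ × All (Incompatible ρ) F)

  Antichain : Subset M → Set
  Antichain Y = ∀ a b → Y a → Y b → a ≤ b → a ≡ b

  IsMaxChain : Subset M → Subset M → Set₁
  IsMaxChain B C = C ⊆ B × IsChain C ×
    (∀ (C' : Subset M) → C' ⊆ B → IsChain C' → C ⊆ C' → C' ⊆ C)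

  IsFront : Subset M → Subset M → Set₁
  IsFront B Y = Y ⊆ B × Antichain Y ×
    (∀ (C : Subset M) → IsMaxChain B C → ∃[ y ] (C y × Y y))

  SameRoot : Subset M → Subset M → Set
  SameRoot B B' = ∃[ r ] (IsLeast B r × IsLeast B' r)

  Sb : Subset M → Subset M → Set₁
  Sb B B' = CWT B' × B' ⊆ B × SameRoot B' B ×
    (∀ ν → B' ν → (Suc B' ν ⊆ Suc B ν) × Finite (λ ρ → Suc B ν ρ × ¬ Suc B' ν ρ))

  AlmostFront : Subset M → Subset M → Set₁
  AlmostFront B Y = Antichain Y × Σ (Subset M) λ B' → (Sb B B' × IsFront B' (Y ∩ B'))

  Psb : Subset M → Subset M → Set₁
  Psb B B' = CWT B' × B' ⊆ B × SameRoot B' B ×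
    (∀ ν → B' ν → ¬ IsMax B ν → (Suc B' ν ⊆ Suc B ν) × Infinite (Suc B' ν))

  _≤*_ : Subset M → Subset M → Set₁
  B₁ ≤* B₂ = SameRoot B₁ B₂ × Σ (Subset M) λ B₂' → (Sb B₂ B₂' × Psb B₁ (B₂' ∩ B₁) ×
    (∀ (Y : Subset M) → AlmostFront (B₂' ∩ B₁) Y → AlmostFront B₂ Y))

InB : {M : Set} → (M → Subset M → Set) → M → Subset M → Set
InB 𝒜 rt B = 𝒜 rt B × ¬ (B ≐ ｛ rt ｝)

-- The class K.  𝒜 η is the family 𝒜^x_η (a set of subsets of M, required to
-- be closed under extensional equality of subsets); _⊑_ is ≤_x.
record K : Set₁ where
  field
    M       : Set
    _≤_     : M → M → Set
    isPO    : IsPartialOrder _≡_ _≤_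
    rt      : M
    rt-least : ∀ ν → rt ≤ ν
    𝒜       : M → Subset M → Set
    _⊑_     : Subset M → Subset M → Set
    𝒜-resp  : ∀ η {B B' : Subset M} → B ≐ B' → 𝒜 η B → 𝒜 η B'
    𝒜-CWT   : ∀ η (B : Subset M) → 𝒜 η B → Order.CWT _≤_ B
    𝒜-root  : ∀ η (B : Subset M) → 𝒜 η B → Order.IsLeast _≤_ B η
    𝒜-single : ∀ η → 𝒜 η ｛ η ｝
    𝒜-closed : ∀ η ν (B : Subset M) → 𝒜 η B → B ν → 𝒜 ν (B ∩ Order.M≥ _≤_ ν)
    ⊑-resp  : ∀ {B₁ B₁' B₂ B₂' : Subset M} → B₁ ≐ B₁' → B₂ ≐ B₂' → B₁ ⊑ B₂ → B₁' ⊑ B₂'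
    ⊑-dom   : ∀ (B₁ B₂ : Subset M) → B₁ ⊑ B₂ → InB 𝒜 rt B₁ × InB 𝒜 rt B₂
    ⊑-refl  : ∀ (B : Subset M) → InB 𝒜 rt B → B ⊑ B
    ⊑-trans : ∀ (B₁ B₂ B₃ : Subset M) → B₁ ⊑ B₂ → B₂ ⊑ B₃ → B₁ ⊑ B₃
    ⊑-antisym : ∀ (B₁ B₂ : Subset M) → B₁ ⊑ B₂ → B₂ ⊑ B₁ → B₁ ≐ B₂
    ⊑-directed : ∀ (B₁ B₂ : Subset M) → InB 𝒜 rt B₁ → InB 𝒜 rt B₂ →
      Σ (Subset M) λ B₃ → (B₁ ⊑ B₃ × B₂ ⊑ B₃)
    ⊑⇒≤*    : ∀ (B₁ B₂ : Subset M) → B₁ ⊑ B₂ → Order._≤*_ _≤_ B₁ B₂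

  𝔅 : Subset M → Set
  𝔅 = InB 𝒜 rt

record _≤K_ (x y : K) : Set₁ where
  private
    module X = K x
    module Y = K y
  field
    emb        : X.M → Y.M
    emb-inj    : ∀ a b → emb a ≡ emb b → a ≡ b
    emb-order  : ∀ a b → (X._≤_ a b ⇔ Y._≤_ (emb a) (emb b))
    emb-incompat : ∀ a b →
      (Order.Incompatible X._≤_ a b ⇔ Order.Incompatible Y._≤_ (emb a) (emb b))
    emb-𝒜      : ∀ η (B : Subset X.M) → X.𝒜 η B → Y.𝒜 (emb η) (Img emb B)
    emb-rt     : Y.rt ≡ emb X.rt
    emb-⊑      : ∀ (B₁ B₂ : Subset X.M) → X.𝔅 B₁ → X.𝔅 B₂ →
      (X._⊑_ B₁ B₂ ⇔ Y._⊑_ (Img emb B₁) (Img emb B₂))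

-- Elements counted by ‖x‖ = |M_x| + Σ_η |𝒜^x_η|, with their equality.
El : K → Set₁
El x = K.M x ⊎ Σ (K.M x) (λ η → Σ (Subset (K.M x)) (K.𝒜 x η))

ElEq : (x : K) → El x → El x → Set
ElEq x (inj₁ a) (inj₁ b) = a ≡ b
ElEq x (inj₂ (η , B , _)) (inj₂ (η' , B' , _)) = η ≡ η' × B ≐ B'
ElEq x _ _ = ⊥

ElℕEq : (x : K) → El x ⊎ ℕ → El x ⊎ ℕ → Set
ElℕEq x (inj₁ a) (inj₁ b) = ElEq x a b
ElℕEq x (inj₂ m) (inj₂ n) = m ≡ n
ElℕEq x _ _ = ⊥

-- ‖y‖ ≤ ‖x‖ + ℵ₀ : an injection of the (quotient) sets
NormLeNormPlusAleph0 : K → K → Set₁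
NormLeNormPlusAleph0 y x = Σ (El y → El x ⊎ ℕ) (λ f →
  (∀ a b → ElEq y a b → ElℕEq x (f a) (f b)) ×
  (∀ a b → ElℕEq x (f a) (f b) → ElEq y a b))

MoreThanOne : (y : K) → K.M y → Set₁
MoreThanOne y η = Σ (Subset (K.M y)) λ B₁ → Σ (Subset (K.M y)) λ B₂ → (K.𝒜 y η B₁ × K.𝒜 y η B₂ × ¬ (B₁ ≐ B₂))

module Submission where

-- Enlarge M_x to M_y = M_x ⊎ ℕ, where the
-- new points are pairwise incomparable and lie above exactly the old points
-- ≤ η, so they form an infinite fan of immediate successors of η.  The fan
-- {η} ∪ ℕ is a CWT in M_y; put 𝒜^y_η = 𝒜^x_η ∪ {fan}, 𝒜^y_n = {{n}} for new
-- n, and 𝒜^y_ν = 𝒜^x_ν otherwise.  Then |𝒜^y_η| > 1 and the new material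
-- (points n, families {n}, the fan) is countable.
--
-- Excluded
-- middle is used to bound chains of the fan and to decide η ≤ ν when
-- transferring the branching axiom.  The hypothesis 𝒜^x_η = {{η}} matters
-- only when η is the root: then 𝔅_x = ∅, and the fan alone forms 𝔅_y.

open import Level using (0ℓ) renaming (suc to lsuc)
open import Data.Empty using (⊥; ⊥-elim)
open import Data.Unit using (⊤; tt)
open import Data.Nat using (ℕ; suc; _+_; _*_; _<_; s≤s)
open import Data.Nat.Properties
  using (m≤m+n; m≤n+m; ≤-trans; <-irrefl; suc-injective; *-cancelˡ-≡; even≢odd)
open import Data.Product using (Σ; ∃-syntax; _×_; _,_; proj₁; proj₂)
open import Data.Sum using (_⊎_; inj₁; inj₂)
open import Data.Sum.Properties using (inj₁-injective; inj₂-injective)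
open import Data.List using (List; []; _∷_; map; _++_)
open import Data.List.Membership.Propositional using (_∈_)
open import Data.List.Membership.Propositional.Properties using (∈-map⁺; ∈-++⁺ˡ; ∈-++⁺ʳ)
open import Data.List.Relation.Unary.Any using (here; there)
open import Data.List.Relation.Unary.All as All using (All; []; _∷_)
import Data.List.Relation.Unary.All.Properties as AllP
open import Relation.Nullary using (¬_; Dec; yes; no)
open import Relation.Unary using (_⊆_; _≐_; _∩_)
open import Relation.Unary.Properties using (≐-refl; ≐-sym; ≐-trans)
open import Relation.Binary.PropositionalEquality
open import Relation.Binary.Structures using (IsPartialOrder)
open import Function.Bundles using (mk⇔)
open import Axiom.ExcludedMiddle using (ExcludedMiddle)
open import Defs

module CWTFacts {M : Set} (_≤_ : M → M → Set) (po : IsPartialOrder _≡_ _≤_) where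
  open Order _≤_
  open IsPartialOrder po using (reflexive)

  finite-⊆ : {P Q : Subset M} → (∀ a → Q a → P a) → Finite P → Finite Q
  finite-⊆ h (xs , f) = xs , λ a q → f a (h a q)

  infinite-⊇ : {P Q : Subset M} → (∀ a → P a → Q a) → Infinite P → Infinite Q
  infinite-⊇ h inf fin = inf (finite-⊆ h fin)

  least-resp : ∀ {B B' r} → B ≐ B' → IsLeast B r → IsLeast B' r
  least-resp (to , from) (r , f) = to r , λ a p → f a (from p)

  suc-resp : ∀ {B B' ν ρ} → B ≐ B' → Suc B ν ρ → Suc B' ν ρ
  suc-resp (to , from) (s , lt , none) =
    to s , lt , λ { (ρ' , b' , l₁ , l₂) → none (ρ' , from b' , l₁ , l₂) }

  max-resp : ∀ {B B' ν} → B ≐ B' → IsMax B ν → IsMax B' ν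
  max-resp (to , from) (s , f) = to s , λ ρ p le → f ρ (from p) le

  cwt-resp : ∀ {B B'} → B ≐ B' → CWT B → CWT B'
  cwt-resp {B} {B'} e@(to , from) c = record
    { countable = (λ { (a , p) → proj₁ C.countable (a , from p) }) ,
                  (λ { (a , p) (b , q) eq → proj₂ C.countable (a , from p) (b , from q) eq })
    ; hasRoot = proj₁ C.hasRoot , least-resp e (proj₂ C.hasRoot)
    ; tree = λ a b c' pa pb pc → C.tree a b c' (from pa) (from pb) (from pc)
    ; chainsFinite = λ Cs sub ch → C.chainsFinite Cs (λ p → from (sub p)) ch
    ; sucEmptyOrInfinite = λ ν p → successors (C.sucEmptyOrInfinite ν (from p))
    ; incomparable⇒incompatible = λ a b pa pb → C.incomparable⇒incompatible a b (from pa) (from pb)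
    ; branching = λ ν p nonmax F avoid →
        infinite-⊇ (λ ρ (s , i) → suc-resp e s , i)
          (C.branching ν (from p) (λ m → nonmax (max-resp e m)) F avoid)
    }
    where
    module C = CWT c
    successors : ∀ {ν} → (∀ ρ → ¬ Suc B ν ρ) ⊎ Infinite (Suc B ν) →
                 (∀ ρ → ¬ Suc B' ν ρ) ⊎ Infinite (Suc B' ν)
    successors (inj₁ none) = inj₁ λ ρ s → none ρ (suc-resp (≐-sym e) s)
    successors (inj₂ inf)  = inj₂ (infinite-⊇ (λ ρ s → suc-resp e s) inf)

  sb-resp : ∀ {B B₀ B'} → B ≐ B₀ → Sb B B' → Sb B₀ B'
  sb-resp e (c , sub , (r , l₁ , l₂) , f) =
    c , (λ p → proj₁ e (sub p)) , (r , l₁ , least-resp e l₂) ,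
    λ ν p → (λ s → suc-resp e (proj₁ (f ν p) s)) ,
            finite-⊆ (λ ρ (s , ns) → suc-resp (≐-sym e) s , ns) (proj₂ (f ν p))

  almostFront-resp : ∀ {B B₀ Y} → B ≐ B₀ → AlmostFront B Y → AlmostFront B₀ Y
  almostFront-resp e (anti , B' , sb , front) = anti , B' , sb-resp e sb , front

  sb-refl : ∀ {B} → CWT B → Sb B B
  sb-refl c = c , (λ p → p) , (r , least , least) ,
    λ ν _ → (λ s → s) , ([] , λ { ρ (s , ns) → ⊥-elim (ns s) })
    where
    r = proj₁ (CWT.hasRoot c)
    least = proj₂ (CWT.hasRoot c)

  -- A CWT whose non-maximal nodes all have infinitely many successors is
  -- ≤*-below itself (taking B₂' = B₂); stated up to extensional equality.
  ≤*-refl : ∀ {B B₁ B₂} → CWT B → (∀ ν → B ν → ¬ IsMax B ν → Infinite (Suc B ν)) →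
    B₁ ≐ B → B₂ ≐ B → B₁ ≤* B₂
  ≤*-refl {B} {B₁} {B₂} c inf e₁ e₂ =
    (r , least-resp (≐-sym e₁) least , least-resp (≐-sym e₂) least) , B₂ ,
    sb-refl (cwt-resp (≐-sym e₂) c) ,
    (cwt-resp (≐-sym meet) c , proj₂ ,
      (r , least-resp (≐-sym meet) least , least-resp (≐-sym e₁) least) ,
      λ ν p nonmax →
        (λ s → suc-resp (≐-trans meet (≐-sym e₁)) s) ,
        infinite-⊇ (λ ρ s → suc-resp (≐-sym meet) s)
          (inf ν (proj₁ meet p) (λ m → nonmax (max-resp (≐-sym e₁) m)))) ,
    λ Y af → almostFront-resp (≐-trans meet (≐-sym e₂)) af
    where
    r = proj₁ (CWT.hasRoot c)
    least = proj₂ (CWT.hasRoot c)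
    meet : (B₂ ∩ B₁) ≐ B
    meet = (λ p → proj₁ e₁ (proj₂ p)) , (λ p → proj₂ e₂ p , proj₂ e₁ p)

  singleton-cwt : ∀ a → CWT ｛ a ｝
  singleton-cwt a = record
    { countable = (λ _ → 0) , λ { (b , p) (c , q) _ → trans p (sym q) }
    ; hasRoot = a , refl , λ b p → reflexive (sym p)
    ; tree = λ _ b c _ pb pc _ _ → inj₁ (reflexive (trans pb (sym pc)))
    ; chainsFinite = λ Cs sub _ → (a ∷ []) , λ b p → here (sub p)
    ; sucEmptyOrInfinite = λ ν p →
        inj₁ λ { ρ (q , (_ , ν≢ρ) , _) → ν≢ρ (trans p (sym q)) }
    ; incomparable⇒incompatible = λ b c pb pc b≰c _ →
        ⊥-elim (b≰c (reflexive (trans pb (sym pc))))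
    ; branching = λ ν p nonmax → ⊥-elim (nonmax (p , λ ρ q _ → trans q (sym p)))
    }

module Extension (em : ExcludedMiddle 0ℓ) (x : K) (η : K.M x) where
  module X = K x
  open IsPartialOrder X.isPO using (antisym) renaming (refl to ≤-refl; trans to ≤-trans')

  My : Set
  My = X.M ⊎ ℕ

  _≤y_ : My → My → Set
  inj₁ a ≤y inj₁ b = X._≤_ a b
  inj₁ a ≤y inj₂ n = X._≤_ a η
  inj₂ m ≤y inj₁ b = ⊥
  inj₂ m ≤y inj₂ n = m ≡ n

  ≤y-refl : ∀ {a} → a ≤y a
  ≤y-refl {inj₁ a} = ≤-refl
  ≤y-refl {inj₂ n} = refl

  ≤y-trans : ∀ {a b c} → a ≤y b → b ≤y c → a ≤y c
  ≤y-trans {inj₁ a} {inj₁ b} {inj₁ c} p q = ≤-trans' p q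
  ≤y-trans {inj₁ a} {inj₁ b} {inj₂ c} p q = ≤-trans' p q
  ≤y-trans {inj₁ a} {inj₂ b} {inj₂ c} p q = p
  ≤y-trans {inj₂ a} {inj₂ b} {inj₂ c} p q = trans p q
  ≤y-trans {inj₁ a} {inj₂ b} {inj₁ c} p ()
  ≤y-trans {inj₂ a} {inj₂ b} {inj₁ c} p ()

  ≤y-antisym : ∀ {a b} → a ≤y b → b ≤y a → a ≡ b
  ≤y-antisym {inj₁ a} {inj₁ b} p q = cong inj₁ (antisym p q)
  ≤y-antisym {inj₂ a} {inj₂ b} p q = cong inj₂ p

  ≤y-isPartialOrder : IsPartialOrder _≡_ _≤y_
  ≤y-isPartialOrder = record
    { isPreorder = record
        { isEquivalence = isEquivalence
        ; reflexive = λ { {a} refl → ≤y-refl {a} }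
        ; trans = λ {a} {b} {c} → ≤y-trans {a} {b} {c} }
    ; antisym = ≤y-antisym }

  module OX = Order X._≤_
  module OY = Order _≤y_
  module FX = CWTFacts X._≤_ X.isPO
  module FY = CWTFacts _≤y_ ≤y-isPartialOrder

  -- Compatibility of old points is the same in M_x and M_y: a new upper
  -- bound n of a and b can be replaced by η.
  compatible-trace : ∀ {a b} → OY.Compatible (inj₁ a) (inj₁ b) → OX.Compatible a b
  compatible-trace (inj₁ c , p , q) = c , p , q
  compatible-trace (inj₂ n , p , q) = η , p , q

  incompatible-trace : ∀ {a b} → OY.Incompatible (inj₁ a) (inj₁ b) → OX.Incompatible a b
  incompatible-trace i (c , p , q) = i (inj₁ c , p , q)

  incompatible-lift : ∀ {a b} → OX.Incompatible a b → OY.Incompatible (inj₁ a) (inj₁ b)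
  incompatible-lift i c = i (compatible-trace c)

  <-trace : ∀ {a b} → OY._<_ (inj₁ a) (inj₁ b) → OX._<_ a b
  <-trace (p , ne) = p , λ e → ne (cong inj₁ e)

  <-lift : ∀ {a b} → OX._<_ a b → OY._<_ (inj₁ a) (inj₁ b)
  <-lift (p , ne) = p , λ e → ne (inj₁-injective e)

  trace : Subset My → Subset X.M
  trace S a = S (inj₁ a)

  incl : Subset X.M → Subset My
  incl B (inj₁ a) = B a
  incl B (inj₂ _) = ⊥

  Old : Subset My → Set
  Old S = ∀ n → ¬ S (inj₂ n)

  incl-old : ∀ B → Old (incl B)
  incl-old B n ()

  old-⊆ : ∀ {S S'} → Old S → S' ⊆ S → Old S'
  old-⊆ o sub n p = o n (sub p)

  old-resp : ∀ {S S'} → S ≐ S' → Old S → Old S'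
  old-resp (_ , from) o n p = o n (from p)

  old-singleton : ∀ ν → Old ｛ inj₁ ν ｝
  old-singleton ν n ()

  trace-resp : ∀ {S S'} → S ≐ S' → trace S ≐ trace S'
  trace-resp (to , from) = to , from

  trace-injective : ∀ {S S'} → Old S → Old S' → trace S ≐ trace S' → S ≐ S'
  trace-injective o o' (to , from) =
    (λ { {inj₁ a} p → to p ; {inj₂ n} p → ⊥-elim (o n p) }) ,
    (λ { {inj₁ a} p → from p ; {inj₂ n} p → ⊥-elim (o' n p) })

  trace-singleton : ∀ ν → ｛ ν ｝ ≐ trace ｛ inj₁ ν ｝
  trace-singleton ν = cong inj₁ , inj₁-injective

  singleton-lift : ∀ {S ν} → Old S → trace S ≐ ｛ ν ｝ → S ≐ ｛ inj₁ ν ｝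
  singleton-lift o e =
    trace-injective o (old-singleton _) (≐-trans e (trace-singleton _))

  singleton-trace : ∀ {S ν} → S ≐ ｛ inj₁ ν ｝ → trace S ≐ ｛ ν ｝
  singleton-trace e = ≐-trans (trace-resp e) (≐-sym (trace-singleton _))

  ⊆-trace : ∀ {S S'} → S' ⊆ S → trace S' ⊆ trace S
  ⊆-trace sub {a} p = sub {inj₁ a} p

  ⊆-lift : ∀ {S S'} → Old S' → trace S' ⊆ trace S → S' ⊆ S
  ⊆-lift o sub {inj₁ a} p = sub p
  ⊆-lift o sub {inj₂ n} p = ⊥-elim (o n p)

  oldPoints : List My → List X.M
  oldPoints [] = []
  oldPoints (inj₁ a ∷ xs) = a ∷ oldPoints xs
  oldPoints (inj₂ _ ∷ xs) = oldPoints xs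

  ∈-oldPoints : ∀ {a xs} → inj₁ a ∈ xs → a ∈ oldPoints xs
  ∈-oldPoints {xs = inj₁ b ∷ xs} (here refl) = here refl
  ∈-oldPoints {xs = inj₁ b ∷ xs} (there p) = there (∈-oldPoints p)
  ∈-oldPoints {xs = inj₂ n ∷ xs} (there p) = ∈-oldPoints p

  finite-trace : ∀ (P : Subset My) → OY.Finite P → OX.Finite (trace P)
  finite-trace P (xs , f) = oldPoints xs , λ a p → ∈-oldPoints (f (inj₁ a) p)

  finite-lift : ∀ {P : Subset My} → Old P → OX.Finite (trace P) → OY.Finite P
  finite-lift {P} o (xs , f) = map inj₁ xs , covered
    where
    covered : ∀ a → P a → a ∈ map inj₁ xs
    covered (inj₁ a) p = ∈-map⁺ inj₁ (f a p)
    covered (inj₂ n) p = ⊥-elim (o n p)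

  countable-trace : ∀ {S} → OY.Countable S → OX.Countable (trace S)
  countable-trace (f , inj) = (λ { (a , p) → f (inj₁ a , p) }) ,
    λ { (a , p) (b , q) e → inj₁-injective (inj (inj₁ a , p) (inj₁ b , q) e) }

  countable-lift : ∀ {S} → Old S → OX.Countable (trace S) → OY.Countable S
  countable-lift {S} o (f , inj) = g , g-inj
    where
    g : Σ My S → ℕ
    g (inj₁ a , p) = f (a , p)
    g (inj₂ n , p) = ⊥-elim (o n p)
    g-inj : ∀ p q → g p ≡ g q → proj₁ p ≡ proj₁ q
    g-inj (inj₁ a , p) (inj₁ b , q) e = cong inj₁ (inj (a , p) (b , q) e)
    g-inj (inj₂ n , p) _ _ = ⊥-elim (o n p)
    g-inj (inj₁ a , p) (inj₂ n , q) _ = ⊥-elim (o n q)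

  suc-trace : ∀ {S ν ρ} → OY.Suc S (inj₁ ν) (inj₁ ρ) → OX.Suc (trace S) ν ρ
  suc-trace (s , lt , none) = s , <-trace lt ,
    λ { (ρ' , s' , l₁ , l₂) → none (inj₁ ρ' , s' , <-lift l₁ , <-lift l₂) }

  suc-lift : ∀ {S ν ρ} → Old S → OX.Suc (trace S) ν ρ → OY.Suc S (inj₁ ν) (inj₁ ρ)
  suc-lift o (s , lt , none) = s , <-lift lt ,
    λ { (inj₁ ρ' , s' , l₁ , l₂) → none (ρ' , s' , <-trace l₁ , <-trace l₂)
      ; (inj₂ n , s' , _) → o n s' }

  max-trace : ∀ {S ν} → OY.IsMax S (inj₁ ν) → OX.IsMax (trace S) ν
  max-trace (s , f) = s , λ ρ s' le → inj₁-injective (f (inj₁ ρ) s' le)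

  max-lift : ∀ {S ν} → Old S → OX.IsMax (trace S) ν → OY.IsMax S (inj₁ ν)
  max-lift o (s , f) =
    s , λ { (inj₁ ρ) s' le → cong inj₁ (f ρ s' le) ; (inj₂ n) s' _ → ⊥-elim (o n s') }

  least-trace : ∀ {S r} → OY.IsLeast S (inj₁ r) → OX.IsLeast (trace S) r
  least-trace (s , f) = s , λ a p → f (inj₁ a) p

  least-lift : ∀ {S r} → Old S → OX.IsLeast (trace S) r → OY.IsLeast S (inj₁ r)
  least-lift o (s , f) = s , λ { (inj₁ a) p → f a p ; (inj₂ n) p → ⊥-elim (o n p) }

  sameRoot-trace : ∀ {S S'} → Old S → OY.SameRoot S S' → OX.SameRoot (trace S) (trace S')
  sameRoot-trace o (inj₁ r , l , l') = r , least-trace l , least-trace l'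
  sameRoot-trace o (inj₂ n , (s , _) , _) = ⊥-elim (o n s)

  sameRoot-lift : ∀ {S S'} → Old S → Old S' →
    OX.SameRoot (trace S) (trace S') → OY.SameRoot S S'
  sameRoot-lift o o' (r , l , l') = inj₁ r , least-lift o l , least-lift o' l'

  chain-incl : ∀ {C} → OX.IsChain C → OY.IsChain (incl C)
  chain-incl ch (inj₁ a) (inj₁ b) ca cb = ch a b ca cb

  chain-trace : ∀ {C} → OY.IsChain C → OX.IsChain (trace C)
  chain-trace ch a b ca cb = ch (inj₁ a) (inj₁ b) ca cb

  -- At an old point ν a new point n
  -- of F is replaced by η when η ≰ ν (a successor of ν incompatible with η
  -- is incompatible with n), and dropped when η ≤ ν (then no successor of ν
  -- is compatible with n at all).
  forbiddenTrace : ∀ {ν} → Dec (X._≤_ η ν) → List My → List X.M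
  forbiddenTrace d [] = []
  forbiddenTrace d (inj₁ a ∷ F) = a ∷ forbiddenTrace d F
  forbiddenTrace (yes η≤ν) (inj₂ n ∷ F) = forbiddenTrace (yes η≤ν) F
  forbiddenTrace (no η≰ν) (inj₂ n ∷ F) = η ∷ forbiddenTrace (no η≰ν) F

  forbiddenTrace-avoids : ∀ {ν} (d : Dec (X._≤_ η ν)) F →
    All (λ μ → ¬ (μ ≤y inj₁ ν)) F → All (λ μ → ¬ X._≤_ μ ν) (forbiddenTrace d F)
  forbiddenTrace-avoids d [] [] = []
  forbiddenTrace-avoids d (inj₁ a ∷ F) (p ∷ ps) = p ∷ forbiddenTrace-avoids d F ps
  forbiddenTrace-avoids (yes η≤ν) (inj₂ n ∷ F) (_ ∷ ps) = forbiddenTrace-avoids (yes η≤ν) F ps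
  forbiddenTrace-avoids (no η≰ν) (inj₂ n ∷ F) (_ ∷ ps) = η≰ν ∷ forbiddenTrace-avoids (no η≰ν) F ps

  forbiddenTrace-incompatible : ∀ {ν ρ} → OX._<_ ν ρ → (d : Dec (X._≤_ η ν)) → ∀ F →
    All (OX.Incompatible ρ) (forbiddenTrace d F) → All (OY.Incompatible (inj₁ ρ)) F
  forbiddenTrace-incompatible ν<ρ d [] _ = []
  forbiddenTrace-incompatible ν<ρ d (inj₁ a ∷ F) (i ∷ is) =
    incompatible-lift i ∷ forbiddenTrace-incompatible ν<ρ d F is
  forbiddenTrace-incompatible {ν} {ρ} ν<ρ (yes η≤ν) (inj₂ n ∷ F) is =
    aboveν ∷ forbiddenTrace-incompatible ν<ρ (yes η≤ν) F is
    where
    aboveν : OY.Incompatible (inj₁ ρ) (inj₂ n)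
    aboveν (inj₂ m , ρ≤η , _) = proj₂ ν<ρ (antisym (proj₁ ν<ρ) (≤-trans' ρ≤η η≤ν))
  forbiddenTrace-incompatible {ν} {ρ} ν<ρ (no η≰ν) (inj₂ n ∷ F) (i ∷ is) =
    incompatibleη ∷ forbiddenTrace-incompatible ν<ρ (no η≰ν) F is
    where
    incompatibleη : OY.Incompatible (inj₁ ρ) (inj₂ n)
    incompatibleη (inj₂ m , ρ≤η , _) = i (η , ρ≤η , ≤-refl)

  branching-lift : ∀ {S} → Old S → OX.CWT (trace S) → ∀ ν → S (inj₁ ν) →
    ¬ OY.IsMax S (inj₁ ν) → (F : List My) → All (λ μ → ¬ (μ ≤y inj₁ ν)) F →
    OY.Infinite (λ ρ → OY.Suc S (inj₁ ν) ρ × All (OY.Incompatible ρ) F)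
  branching-lift {S} o c ν s nonmax F avoid fin =
    OX.CWT.branching c ν s (λ m → nonmax (max-lift o m))
      (forbiddenTrace d F) (forbiddenTrace-avoids d F avoid)
      (FX.finite-⊆ good (finite-trace _ fin))
    where
    d = em {X._≤_ η ν}
    good : ∀ ρ → OX.Suc (trace S) ν ρ × All (OX.Incompatible ρ) (forbiddenTrace d F) →
           OY.Suc S (inj₁ ν) (inj₁ ρ) × All (OY.Incompatible (inj₁ ρ)) F
    good ρ (sc , is) = suc-lift o sc , forbiddenTrace-incompatible (proj₁ (proj₂ sc)) d F is

  cwt-lift : ∀ {S} → Old S → OX.CWT (trace S) → OY.CWT S
  cwt-lift {S} o c = record
    { countable = countable-lift o C.countable
    ; hasRoot = inj₁ (proj₁ C.hasRoot) , least-lift o (proj₂ C.hasRoot)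
    ; tree = tree
    ; chainsFinite = λ Cs sub ch →
        finite-lift (old-⊆ {S} {Cs} o sub)
          (C.chainsFinite (trace Cs) (⊆-trace {S} {Cs} sub) (chain-trace ch))
    ; sucEmptyOrInfinite = successors
    ; incomparable⇒incompatible = incompatible
    ; branching = branching
    }
    where
    module C = OX.CWT c
    tree : OY.IsTree S
    tree (inj₁ a) (inj₁ b) (inj₁ c') = C.tree a b c'
    tree (inj₂ n) _ _ sa _ _ _ _ = ⊥-elim (o n sa)
    tree _ (inj₂ n) _ _ sb _ _ _ = ⊥-elim (o n sb)
    tree _ _ (inj₂ n) _ _ sc _ _ = ⊥-elim (o n sc)
    successors : ∀ ν → S ν → (∀ ρ → ¬ OY.Suc S ν ρ) ⊎ OY.Infinite (OY.Suc S ν)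
    successors (inj₂ n) s = ⊥-elim (o n s)
    successors (inj₁ ν) s with C.sucEmptyOrInfinite ν s
    ... | inj₁ none = inj₁ λ { (inj₁ ρ) sc → none ρ (suc-trace sc)
                             ; (inj₂ n) sc → o n (proj₁ sc) }
    ... | inj₂ inf = inj₂ λ fin →
            inf (FX.finite-⊆ (λ ρ → suc-lift o) (finite-trace _ fin))
    incompatible : ∀ a b → S a → S b → ¬ (a ≤y b) → ¬ (b ≤y a) → OY.Incompatible a b
    incompatible (inj₁ a) (inj₁ b) sa sb a≰b b≰a =
      incompatible-lift (C.incomparable⇒incompatible a b sa sb a≰b b≰a)
    incompatible (inj₂ n) _ sa _ _ _ = ⊥-elim (o n sa)
    incompatible (inj₁ _) (inj₂ n) _ sb _ _ = ⊥-elim (o n sb)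
    branching : ∀ ν → S ν → ¬ OY.IsMax S ν → (F : List My) → All (λ μ → ¬ (μ ≤y ν)) F →
      OY.Infinite (λ ρ → OY.Suc S ν ρ × All (OY.Incompatible ρ) F)
    branching (inj₁ ν) = branching-lift o c ν
    branching (inj₂ n) s = ⊥-elim (o n s)

  cwt-trace : ∀ {S} → Old S → OY.CWT S → OX.CWT (trace S)
  cwt-trace {S} o c = record
    { countable = countable-trace C.countable
    ; hasRoot = root C.hasRoot
    ; tree = λ a b c' → C.tree (inj₁ a) (inj₁ b) (inj₁ c')
    ; chainsFinite = λ Cs sub ch →
        finite-trace (incl Cs) (C.chainsFinite (incl Cs) (λ { {inj₁ a} p → sub p }) (chain-incl ch))
    ; sucEmptyOrInfinite = successors
    ; incomparable⇒incompatible = λ a b sa sb a≰b b≰a →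
        incompatible-trace (C.incomparable⇒incompatible (inj₁ a) (inj₁ b) sa sb a≰b b≰a)
    ; branching = branching
    }
    where
    module C = OY.CWT c
    root : ∃[ r ] OY.IsLeast S r → ∃[ r ] OX.IsLeast (trace S) r
    root (inj₁ r , l) = r , least-trace l
    root (inj₂ n , (s , _)) = ⊥-elim (o n s)
    successors : ∀ ν → trace S ν →
      (∀ ρ → ¬ OX.Suc (trace S) ν ρ) ⊎ OX.Infinite (OX.Suc (trace S) ν)
    successors ν s with C.sucEmptyOrInfinite (inj₁ ν) s
    ... | inj₁ none = inj₁ λ ρ sc → none (inj₁ ρ) (suc-lift o sc)
    ... | inj₂ inf = inj₂ λ fin →
            inf (finite-lift (λ n p → o n (proj₁ p)) (FX.finite-⊆ (λ ρ → suc-trace) fin))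
    branching : ∀ ν → trace S ν → ¬ OX.IsMax (trace S) ν → (F : List X.M) →
      All (λ μ → ¬ X._≤_ μ ν) F →
      OX.Infinite (λ ρ → OX.Suc (trace S) ν ρ × All (OX.Incompatible ρ) F)
    branching ν s nonmax F avoid fin =
      C.branching (inj₁ ν) s (λ m → nonmax (max-trace m)) (map inj₁ F) (AllP.map⁺ avoid)
        (finite-lift (λ n p → o n (proj₁ (proj₁ p))) (FX.finite-⊆ good fin))
      where
      good : ∀ ρ → OY.Suc S (inj₁ ν) (inj₁ ρ) × All (OY.Incompatible (inj₁ ρ)) (map inj₁ F) →
             OX.Suc (trace S) ν ρ × All (OX.Incompatible ρ) F
      good ρ (sc , is) = suc-trace sc , All.map incompatible-trace (AllP.map⁻ is)

  sb-trace : ∀ {S S'} → Old S → OY.Sb S S' → OX.Sb (trace S) (trace S')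
  sb-trace {S} {S'} o (c , sub , same , f) =
    cwt-trace o' c , ⊆-trace {S} {S'} sub , sameRoot-trace o' same , successors
    where
    o' = old-⊆ {S} {S'} o sub
    successors : ∀ ν → trace S' ν → (OX.Suc (trace S') ν ⊆ OX.Suc (trace S) ν) ×
      OX.Finite (λ ρ → OX.Suc (trace S) ν ρ × ¬ OX.Suc (trace S') ν ρ)
    successors ν s =
      (λ p → suc-trace (proj₁ (f (inj₁ ν) s) (suc-lift o' p))) ,
      FX.finite-⊆ (λ ρ (sc , ns) → suc-lift o sc , λ s' → ns (suc-trace s'))
        (finite-trace _ (proj₂ (f (inj₁ ν) s)))

  sb-lift : ∀ {S S'} → Old S → Old S' → OX.Sb (trace S) (trace S') → OY.Sb S S'
  sb-lift {S} {S'} o o' (c , sub , same , f) =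
    cwt-lift o' c , ⊆-lift {S} {S'} o' sub , sameRoot-lift o' o same , successors
    where
    successors : ∀ ν → S' ν → (OY.Suc S' ν ⊆ OY.Suc S ν) ×
      OY.Finite (λ ρ → OY.Suc S ν ρ × ¬ OY.Suc S' ν ρ)
    successors (inj₂ n) s = ⊥-elim (o' n s)
    successors (inj₁ ν) s =
      (λ { {inj₁ ρ} p → suc-lift o (proj₁ (f ν s) (suc-trace p))
         ; {inj₂ n} p → ⊥-elim (o' n (proj₁ p)) }) ,
      finite-lift (λ n p → o n (proj₁ (proj₁ p)))
        (FX.finite-⊆ (λ ρ (sc , ns) → suc-trace sc , λ s' → ns (suc-lift o' s')) (proj₂ (f ν s)))

  psb-lift : ∀ {S S'} → Old S → Old S' → OX.Psb (trace S) (trace S') → OY.Psb S S'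
  psb-lift {S} {S'} o o' (c , sub , same , f) =
    cwt-lift o' c , ⊆-lift {S} {S'} o' sub , sameRoot-lift o' o same , successors
    where
    successors : ∀ ν → S' ν → ¬ OY.IsMax S ν →
      (OY.Suc S' ν ⊆ OY.Suc S ν) × OY.Infinite (OY.Suc S' ν)
    successors (inj₂ n) s _ = ⊥-elim (o' n s)
    successors (inj₁ ν) s nonmax =
      (λ { {inj₁ ρ} p → suc-lift o (proj₁ (f ν s nonmax') (suc-trace p))
         ; {inj₂ n} p → ⊥-elim (o' n (proj₁ p)) }) ,
      λ fin → proj₂ (f ν s nonmax') (FX.finite-⊆ (λ ρ → suc-lift o') (finite-trace _ fin))
      where
      nonmax' = λ m → nonmax (max-lift o m)

  antichain-trace : ∀ {Y} → OY.Antichain Y → OX.Antichain (trace Y)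
  antichain-trace anti a b ya yb le = inj₁-injective (anti (inj₁ a) (inj₁ b) ya yb le)

  antichain-lift : ∀ {Y} → Old Y → OX.Antichain (trace Y) → OY.Antichain Y
  antichain-lift oy anti (inj₁ a) (inj₁ b) ya yb le = cong inj₁ (anti a b ya yb le)
  antichain-lift oy anti (inj₂ n) _ ya _ _ = ⊥-elim (oy n ya)
  antichain-lift oy anti (inj₁ _) (inj₂ n) _ yb _ = ⊥-elim (oy n yb)

  maxChain-trace : ∀ {B C} → Old B → OY.IsMaxChain B C → OX.IsMaxChain (trace B) (trace C)
  maxChain-trace {B} {C} o (sub , ch , maximal) =
    ⊆-trace {B} {C} sub , chain-trace ch ,
    λ C' sub' ch' C⊆C' {a} p →
      maximal (incl C') (λ { {inj₁ b} q → sub' q }) (chain-incl ch')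
        (λ { {inj₁ b} q → C⊆C' q ; {inj₂ n} q → ⊥-elim (o n (sub q)) }) {inj₁ a} p

  maxChain-lift : ∀ {B C} → Old B → OX.IsMaxChain (trace B) C → OY.IsMaxChain B (incl C)
  maxChain-lift {B} {C} o (sub , ch , maximal) =
    (λ { {inj₁ b} q → sub q }) , chain-incl ch ,
    λ { C' sub' ch' C⊆C' {inj₁ a} p →
          maximal (trace C') (⊆-trace {B} {C'} sub') (chain-trace ch') C⊆C' p
      ; C' sub' ch' C⊆C' {inj₂ n} p → ⊥-elim (o n (sub' p)) }

  front-trace : ∀ {B Y} → Old B → OY.IsFront B Y → OX.IsFront (trace B) (trace Y)
  front-trace {B} {Y} o (sub , anti , meets) =
    ⊆-trace {B} {Y} sub , antichain-trace anti , meets'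
    where
    meets' : ∀ C → OX.IsMaxChain (trace B) C → ∃[ a ] (C a × trace Y a)
    meets' C mc with meets (incl C) (maxChain-lift o mc)
    ... | inj₁ a , ca , ya = a , ca , ya

  front-lift : ∀ {B Y} → Old B → Old Y → OX.IsFront (trace B) (trace Y) → OY.IsFront B Y
  front-lift {B} {Y} o oy (sub , anti , meets) =
    ⊆-lift {B} {Y} oy sub , antichain-lift oy anti , meets'
    where
    meets' : ∀ C → OY.IsMaxChain B C → ∃[ a ] (C a × Y a)
    meets' C mc with meets (trace C) (maxChain-trace o mc)
    ... | a , ca , ya = inj₁ a , ca , ya

  ≤*-lift : ∀ {S₁ S₂} → Old S₁ → Old S₂ → OX._≤*_ (trace S₁) (trace S₂) → OY._≤*_ S₁ S₂
  ≤*-lift {S₁} {S₂} o₁ o₂ (same , B₂' , sb , psb , almostFronts) =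
    sameRoot-lift o₁ o₂ same , incl B₂' , sb-lift o₂ (incl-old B₂') sb ,
    psb-lift o₁ o-meet psb , almostFronts'
    where
    o-meet : Old (incl B₂' ∩ S₁)
    o-meet n p = o₁ n (proj₂ p)
    almostFronts' : ∀ Y → OY.AlmostFront (incl B₂' ∩ S₁) Y → OY.AlmostFront S₂ Y
    almostFronts' Y (anti , B'' , sb'' , front'')
      with almostFronts (trace Y)
             (antichain-trace anti , trace B'' ,
              sb-trace {incl B₂' ∩ S₁} {B''} o-meet sb'' ,
              front-trace (old-⊆ {incl B₂' ∩ S₁} {B''} o-meet (proj₁ (proj₂ sb''))) front'')
    ... | _ , B₃ , sb₃ , front₃ =
      anti , incl B₃ , sb-lift o₂ (incl-old B₃) sb₃ ,
      front-lift (incl-old B₃) (λ n p → incl-old B₃ n (proj₂ p)) front₃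

  bound : List My → ℕ
  bound [] = 0
  bound (inj₁ _ ∷ xs) = bound xs
  bound (inj₂ m ∷ xs) = suc m + bound xs

  bound-> : ∀ {n xs} → inj₂ n ∈ xs → n < bound xs
  bound-> {xs = inj₁ a ∷ xs} (there p) = bound-> p
  bound-> {xs = inj₂ m ∷ xs} (here refl) = s≤s (m≤m+n m (bound xs))
  bound-> {xs = inj₂ m ∷ xs} (there p) = ≤-trans (bound-> p) (m≤n+m (bound xs) (suc m))

  bound-fresh : ∀ xs → ¬ (inj₂ (bound xs) ∈ xs)
  bound-fresh xs p = <-irrefl refl (bound-> p)

  cofinitelyNew-infinite : ∀ {P : Subset My} (F : List My) →
    (∀ n → ¬ (inj₂ n ∈ F) → P (inj₂ n)) → OY.Infinite P
  cofinitelyNew-infinite F new (xs , fin) =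
    bound-fresh (F ++ xs) (∈-++⁺ʳ F (fin (inj₂ k) (new k (λ p → bound-fresh (F ++ xs) (∈-++⁺ˡ p)))))
    where k = bound (F ++ xs)

  Fan : Subset My
  Fan (inj₁ a) = a ≡ η
  Fan (inj₂ _) = ⊤

  fan-least : ∀ b → Fan b → inj₁ η ≤y b
  fan-least (inj₁ b) refl = ≤-refl
  fan-least (inj₂ n) _ = ≤-refl

  fan-suc : ∀ n → OY.Suc Fan (inj₁ η) (inj₂ n)
  fan-suc n = tt , (≤-refl , λ ()) ,
    λ { (inj₁ a , refl , (_ , ne) , _) → ne refl
      ; (inj₂ m , _ , _ , (le , ne)) → ne (cong inj₂ le) }

  fan-max : ∀ n → OY.IsMax Fan (inj₂ n)
  fan-max n = tt , λ { (inj₂ m) _ le → cong inj₂ (sym le) }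

  fan-no-old-max : ∀ {a} → Fan (inj₁ a) → ¬ OY.IsMax Fan (inj₁ a)
  fan-no-old-max refl (_ , f) with f (inj₂ 0) tt ≤-refl
  ... | ()

  new-incompatible : ∀ n μ → ¬ (μ ≤y inj₁ η) → ¬ (inj₂ n ≡ μ) → OY.Incompatible (inj₂ n) μ
  new-incompatible n (inj₁ a) a≰η _ (inj₂ k , _ , a≤k) = a≰η a≤k
  new-incompatible n (inj₂ j) _ n≢j (inj₂ k , n≡k , j≡k) = n≢j (cong inj₂ (trans n≡k (sym j≡k)))

  new-incompatibleAll : ∀ n F → All (λ μ → ¬ (μ ≤y inj₁ η)) F → ¬ (inj₂ n ∈ F) →
    All (OY.Incompatible (inj₂ n)) F
  new-incompatibleAll n [] [] _ = []
  new-incompatibleAll n (μ ∷ F) (μ≰η ∷ avoid) n∉ =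
    new-incompatible n μ μ≰η (λ e → n∉ (here e)) ∷
    new-incompatibleAll n F avoid (λ p → n∉ (there p))

  -- Every chain of the fan has at most two points (root and one new point);
  -- excluded middle decides whether it contains a new point.
  fan-chainsFinite : OY.ChainsFinite Fan
  fan-chainsFinite Cs sub ch with em {∃[ n ] Cs (inj₂ n)}
  ... | yes (n , cn) = (inj₁ η ∷ inj₂ n ∷ []) , listed
    where
    listed : ∀ b → Cs b → b ∈ (inj₁ η ∷ inj₂ n ∷ [])
    listed (inj₁ a) p with sub {inj₁ a} p
    ... | refl = here refl
    listed (inj₂ m) p with ch (inj₂ m) (inj₂ n) p cn
    ... | inj₁ m≡n = there (here (cong inj₂ m≡n))
    ... | inj₂ n≡m = there (here (cong inj₂ (sym n≡m)))
  ... | no noNew = (inj₁ η ∷ []) , listed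
    where
    listed : ∀ b → Cs b → b ∈ (inj₁ η ∷ [])
    listed (inj₁ a) p with sub {inj₁ a} p
    ... | refl = here refl
    listed (inj₂ m) p = ⊥-elim (noNew (m , p))

  fan-nonmax-infinite : ∀ ν → Fan ν → ¬ OY.IsMax Fan ν → OY.Infinite (OY.Suc Fan ν)
  fan-nonmax-infinite (inj₁ a) refl _ = cofinitelyNew-infinite [] (λ n _ → fan-suc n)
  fan-nonmax-infinite (inj₂ n) _ nonmax = ⊥-elim (nonmax (fan-max n))

  fan-cwt : OY.CWT Fan
  fan-cwt = record
    { countable = code , code-injective
    ; hasRoot = inj₁ η , refl , fan-least
    ; tree = tree
    ; chainsFinite = fan-chainsFinite
    ; sucEmptyOrInfinite = successors
    ; incomparable⇒incompatible = incompatible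
    ; branching = branching
    }
    where
    code : Σ My Fan → ℕ
    code (inj₁ _ , _) = 0
    code (inj₂ n , _) = suc n
    code-injective : ∀ p q → code p ≡ code q → proj₁ p ≡ proj₁ q
    code-injective (inj₁ a , refl) (inj₁ b , refl) _ = refl
    code-injective (inj₂ n , _) (inj₂ m , _) e = cong inj₂ (suc-injective e)
    tree : OY.IsTree Fan
    tree _ (inj₁ b) c _ pb pc _ _ = inj₁ (subst (λ a → inj₁ a ≤y c) (sym pb) (fan-least c pc))
    tree _ b (inj₁ c) _ pb pc _ _ = inj₂ (subst (λ a → inj₁ a ≤y b) (sym pc) (fan-least b pb))
    tree (inj₂ k) (inj₂ m) (inj₂ j) _ _ _ m≡k j≡k = inj₁ (trans m≡k (sym j≡k))
    successors : ∀ ν → Fan ν → (∀ ρ → ¬ OY.Suc Fan ν ρ) ⊎ OY.Infinite (OY.Suc Fan ν)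
    successors (inj₁ a) p = inj₂ (fan-nonmax-infinite (inj₁ a) p (fan-no-old-max p))
    successors (inj₂ n) _ = inj₁ λ { (inj₂ m) (_ , (n≡m , n≢m) , _) → n≢m (cong inj₂ n≡m) }
    incompatible : ∀ a b → Fan a → Fan b → ¬ (a ≤y b) → ¬ (b ≤y a) → OY.Incompatible a b
    incompatible (inj₁ a) b refl pb a≰b _ = ⊥-elim (a≰b (fan-least b pb))
    incompatible (inj₂ n) (inj₁ b) _ refl _ b≰a = ⊥-elim (b≰a (fan-least (inj₂ n) tt))
    incompatible (inj₂ n) (inj₂ m) _ _ n≰m _ (inj₂ k , n≡k , m≡k) = n≰m (trans n≡k (sym m≡k))
    branching : ∀ ν → Fan ν → ¬ OY.IsMax Fan ν → (F : List My) → All (λ μ → ¬ (μ ≤y ν)) F →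
      OY.Infinite (λ ρ → OY.Suc Fan ν ρ × All (OY.Incompatible ρ) F)
    branching (inj₁ a) refl _ F avoid =
      cofinitelyNew-infinite F (λ n n∉F → fan-suc n , new-incompatibleAll n F avoid n∉F)
    branching (inj₂ n) _ nonmax = ⊥-elim (nonmax (fan-max n))

  fan-not-old : ∀ {S} → S ≐ Fan → ¬ Old S
  fan-not-old (_ , from) o = o 0 (from {inj₂ 0} tt)

  𝒜y : My → Subset My → Set
  𝒜y (inj₁ ν) S = (X.𝒜 ν (trace S) × Old S) ⊎ (ν ≡ η × S ≐ Fan)
  𝒜y (inj₂ n) S = S ≐ ｛ inj₂ n ｝

  -- ≤_y is ≤_x on old sets.  If η is the root, the fan becomes a member of
  -- 𝔅_y, related only to itself.
  _⊑y_ : Subset My → Subset My → Set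
  S₁ ⊑y S₂ = (X._⊑_ (trace S₁) (trace S₂) × Old S₁ × Old S₂) ⊎ (X.rt ≡ η × S₁ ≐ Fan × S₂ ≐ Fan)

  𝔅y : Subset My → Set
  𝔅y = InB 𝒜y (inj₁ X.rt)

  𝔅-old : ∀ {B} → X.𝔅 (trace B) → Old B → 𝔅y B
  𝔅-old (a , nontrivial) o = inj₁ (a , o) , λ e → nontrivial (singleton-trace e)

  𝔅-trace : ∀ {B} → X.𝒜 X.rt (trace B) → Old B → 𝔅y B → X.𝔅 (trace B)
  𝔅-trace a o (_ , nontrivial) = a , λ e → nontrivial (singleton-lift o e)

  𝔅-fan : ∀ {B} → X.rt ≡ η → B ≐ Fan → 𝔅y B
  𝔅-fan rt≡η e = inj₂ (rt≡η , e) , λ e' → new≢old (proj₁ e' (proj₂ e {inj₂ 0} tt))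
    where
    new≢old : ∀ {n} → ¬ (inj₂ n ≡ inj₁ X.rt)
    new≢old ()

  module Build (only-singleton : ∀ B → X.𝒜 η B → B ≐ ｛ η ｝) where

    -- If η is the root, 𝔅_x is empty, so 𝔅_y contains only the fan.
    root-no-old : X.rt ≡ η → ∀ {B} → 𝔅y B → X.𝒜 X.rt (trace B) → Old B → ⊥
    root-no-old refl (_ , nontrivial) a o =
      nontrivial (singleton-lift o (only-singleton _ a))

    𝒜y-resp : ∀ ν {B B' : Subset My} → B ≐ B' → 𝒜y ν B → 𝒜y ν B'
    𝒜y-resp (inj₁ ν) e (inj₁ (a , o)) = inj₁ (X.𝒜-resp ν (trace-resp e) a , old-resp e o)
    𝒜y-resp (inj₁ ν) e (inj₂ (ν≡η , e')) = inj₂ (ν≡η , ≐-trans (≐-sym e) e')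
    𝒜y-resp (inj₂ n) e e' = ≐-trans (≐-sym e) e'

    𝒜y-CWT : ∀ ν (B : Subset My) → 𝒜y ν B → OY.CWT B
    𝒜y-CWT (inj₁ ν) B (inj₁ (a , o)) = cwt-lift o (X.𝒜-CWT ν (trace B) a)
    𝒜y-CWT (inj₁ ν) B (inj₂ (_ , e)) = FY.cwt-resp (≐-sym e) fan-cwt
    𝒜y-CWT (inj₂ n) B e = FY.cwt-resp (≐-sym e) (FY.singleton-cwt (inj₂ n))

    𝒜y-root : ∀ ν (B : Subset My) → 𝒜y ν B → OY.IsLeast B ν
    𝒜y-root (inj₁ ν) B (inj₁ (a , o)) = least-lift o (X.𝒜-root ν (trace B) a)
    𝒜y-root (inj₁ ν) B (inj₂ (refl , e)) = FY.least-resp (≐-sym e) (refl , fan-least)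
    𝒜y-root (inj₂ n) B e = FY.least-resp (≐-sym e) (refl , λ { b refl → refl })

    𝒜y-single : ∀ ν → 𝒜y ν ｛ ν ｝
    𝒜y-single (inj₁ ν) =
      inj₁ (X.𝒜-resp ν (trace-singleton ν) (X.𝒜-single ν) , old-singleton ν)
    𝒜y-single (inj₂ n) = ≐-refl

    -- Closure under B ↦ B ∩ M_{≥ν}: the cone of the fan above its root is the
    -- fan, above a new point n it is {n}.
    𝒜y-closed : ∀ μ ν (B : Subset My) → 𝒜y μ B → B ν → 𝒜y ν (B ∩ OY.M≥ ν)
    𝒜y-closed (inj₁ μ) (inj₁ ν) B (inj₁ (a , o)) s =
      inj₁ (X.𝒜-closed μ ν (trace B) a s , λ n p → o n (proj₁ p))
    𝒜y-closed (inj₁ μ) (inj₂ n) B (inj₁ (a , o)) s = ⊥-elim (o n s)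
    𝒜y-closed (inj₁ μ) (inj₁ ν) B (inj₂ (_ , e)) s with proj₁ e {inj₁ ν} s
    ... | refl = inj₂ (refl , (λ p → proj₁ e (proj₁ p)) , λ {b} p → proj₂ e p , fan-least b p)
    𝒜y-closed (inj₁ μ) (inj₂ n) B (inj₂ (_ , e)) s =
      (λ { {inj₂ m} (_ , n≡m) → cong inj₂ (sym n≡m) }) , λ { refl → proj₂ e tt , refl }
    𝒜y-closed (inj₂ m) ν B e s with proj₁ e s
    ... | refl = (λ p → proj₁ e (proj₁ p)) , λ { refl → proj₂ e refl , refl }

    ⊑y-resp : ∀ {B₁ B₁' B₂ B₂' : Subset My} → B₁ ≐ B₁' → B₂ ≐ B₂' → B₁ ⊑y B₂ → B₁' ⊑y B₂'
    ⊑y-resp e₁ e₂ (inj₁ (r , o₁ , o₂)) =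
      inj₁ (X.⊑-resp (trace-resp e₁) (trace-resp e₂) r , old-resp e₁ o₁ , old-resp e₂ o₂)
    ⊑y-resp e₁ e₂ (inj₂ (rt≡η , f₁ , f₂)) = inj₂ (rt≡η , ≐-trans (≐-sym e₁) f₁ , ≐-trans (≐-sym e₂) f₂)

    ⊑y-dom : ∀ (B₁ B₂ : Subset My) → B₁ ⊑y B₂ → 𝔅y B₁ × 𝔅y B₂
    ⊑y-dom B₁ B₂ (inj₁ (r , o₁ , o₂)) with X.⊑-dom (trace B₁) (trace B₂) r
    ... | d₁ , d₂ = 𝔅-old d₁ o₁ , 𝔅-old d₂ o₂
    ⊑y-dom B₁ B₂ (inj₂ (rt≡η , f₁ , f₂)) = 𝔅-fan rt≡η f₁ , 𝔅-fan rt≡η f₂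

    ⊑y-refl : ∀ (B : Subset My) → 𝔅y B → B ⊑y B
    ⊑y-refl B b@(inj₁ (a , o) , _) = inj₁ (X.⊑-refl (trace B) (𝔅-trace a o b) , o , o)
    ⊑y-refl B (inj₂ (rt≡η , f) , _) = inj₂ (rt≡η , f , f)

    ⊑y-trans : ∀ (B₁ B₂ B₃ : Subset My) → B₁ ⊑y B₂ → B₂ ⊑y B₃ → B₁ ⊑y B₃
    ⊑y-trans B₁ B₂ B₃ (inj₁ (r , o₁ , _)) (inj₁ (r' , _ , o₃)) =
      inj₁ (X.⊑-trans _ _ _ r r' , o₁ , o₃)
    ⊑y-trans B₁ B₂ B₃ (inj₂ (rt≡η , f₁ , _)) (inj₂ (_ , _ , f₃)) = inj₂ (rt≡η , f₁ , f₃)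
    ⊑y-trans B₁ B₂ B₃ (inj₁ (_ , _ , o₂)) (inj₂ (_ , f₂ , _)) = ⊥-elim (fan-not-old f₂ o₂)
    ⊑y-trans B₁ B₂ B₃ (inj₂ (_ , _ , f₂)) (inj₁ (_ , o₂ , _)) = ⊥-elim (fan-not-old f₂ o₂)

    ⊑y-antisym : ∀ (B₁ B₂ : Subset My) → B₁ ⊑y B₂ → B₂ ⊑y B₁ → B₁ ≐ B₂
    ⊑y-antisym B₁ B₂ (inj₁ (r , o₁ , o₂)) (inj₁ (r' , _ , _)) =
      trace-injective o₁ o₂ (X.⊑-antisym _ _ r r')
    ⊑y-antisym B₁ B₂ (inj₂ (_ , f₁ , f₂)) _ = ≐-trans f₁ (≐-sym f₂)
    ⊑y-antisym B₁ B₂ (inj₁ (_ , _ , o₂)) (inj₂ (_ , f₂ , _)) = ⊥-elim (fan-not-old f₂ o₂)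

    ⊑y-directed : ∀ (B₁ B₂ : Subset My) → 𝔅y B₁ → 𝔅y B₂ →
      Σ (Subset My) λ B₃ → (B₁ ⊑y B₃ × B₂ ⊑y B₃)
    ⊑y-directed B₁ B₂ b₁@(inj₁ (a₁ , o₁) , _) b₂@(inj₁ (a₂ , o₂) , _)
      with X.⊑-directed (trace B₁) (trace B₂) (𝔅-trace a₁ o₁ b₁) (𝔅-trace a₂ o₂ b₂)
    ... | B₃ , r₁ , r₂ = incl B₃ , inj₁ (r₁ , o₁ , incl-old B₃) , inj₁ (r₂ , o₂ , incl-old B₃)
    ⊑y-directed B₁ B₂ (inj₂ (rt≡η , f₁) , _) (inj₂ (_ , f₂) , _) =
      Fan , inj₂ (rt≡η , f₁ , ≐-refl) , inj₂ (rt≡η , f₂ , ≐-refl)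
    ⊑y-directed B₁ B₂ b₁@(inj₁ (a₁ , o₁) , _) (inj₂ (rt≡η , _) , _) =
      ⊥-elim (root-no-old rt≡η b₁ a₁ o₁)
    ⊑y-directed B₁ B₂ (inj₂ (rt≡η , _) , _) b₂@(inj₁ (a₂ , o₂) , _) =
      ⊥-elim (root-no-old rt≡η b₂ a₂ o₂)

    ⊑y⇒≤* : ∀ (B₁ B₂ : Subset My) → B₁ ⊑y B₂ → OY._≤*_ B₁ B₂
    ⊑y⇒≤* B₁ B₂ (inj₁ (r , o₁ , o₂)) = ≤*-lift o₁ o₂ (X.⊑⇒≤* _ _ r)
    ⊑y⇒≤* B₁ B₂ (inj₂ (_ , f₁ , f₂)) = FY.≤*-refl fan-cwt fan-nonmax-infinite f₁ f₂

    y : K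
    y = record
      { M = My ; _≤_ = _≤y_ ; isPO = ≤y-isPartialOrder ; rt = inj₁ X.rt
      ; rt-least = λ { (inj₁ a) → X.rt-least a ; (inj₂ n) → X.rt-least η }
      ; 𝒜 = 𝒜y ; _⊑_ = _⊑y_
      ; 𝒜-resp = 𝒜y-resp ; 𝒜-CWT = 𝒜y-CWT ; 𝒜-root = 𝒜y-root ; 𝒜-single = 𝒜y-single
      ; 𝒜-closed = 𝒜y-closed ; ⊑-resp = ⊑y-resp ; ⊑-dom = ⊑y-dom ; ⊑-refl = ⊑y-refl
      ; ⊑-trans = ⊑y-trans ; ⊑-antisym = ⊑y-antisym ; ⊑-directed = ⊑y-directed
      ; ⊑⇒≤* = ⊑y⇒≤* }

    image-trace : ∀ B → B ≐ trace (Img inj₁ B)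
    image-trace B = (λ {a} b → a , b , refl) , λ { (a' , b , refl) → b }

    image-old : ∀ B → Old (Img inj₁ B)
    image-old B n (a , _ , ())

    x≤y : x ≤K y
    x≤y = record
      { emb = inj₁
      ; emb-inj = λ a b → inj₁-injective
      ; emb-order = λ a b → mk⇔ (λ p → p) (λ p → p)
      ; emb-incompat = λ a b → mk⇔ incompatible-lift incompatible-trace
      ; emb-𝒜 = λ ν B a → inj₁ (X.𝒜-resp ν (image-trace B) a , image-old B)
      ; emb-rt = refl
      ; emb-⊑ = λ B₁ B₂ _ _ → mk⇔
          (λ r → inj₁ (X.⊑-resp (image-trace B₁) (image-trace B₂) r , image-old B₁ , image-old B₂))
          (λ { (inj₁ (r , _ , _)) → X.⊑-resp (≐-sym (image-trace B₁)) (≐-sym (image-trace B₂)) r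
             ; (inj₂ (_ , f , _)) → ⊥-elim (fan-not-old f (image-old B₁)) })
      }

    two-families : MoreThanOne y (inj₁ η)
    two-families = ｛ inj₁ η ｝ , Fan , 𝒜y-single (inj₁ η) , inj₂ (refl , ≐-refl) ,
      λ e → fan-not-old e (old-singleton η)

    code : El y → El x ⊎ ℕ
    code (inj₁ (inj₁ a)) = inj₁ (inj₁ a)
    code (inj₁ (inj₂ n)) = inj₂ (suc (2 * n))
    code (inj₂ (inj₁ ν , S , inj₁ (a , _))) = inj₁ (inj₂ (ν , trace S , a))
    code (inj₂ (inj₁ ν , S , inj₂ _)) = inj₂ 0
    code (inj₂ (inj₂ n , S , _)) = inj₂ (2 * suc n)

    double-injective : ∀ {m n} → 2 * m ≡ 2 * n → m ≡ n
    double-injective {m} {n} = *-cancelˡ-≡ m n 2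

    code-resp : ∀ a b → ElEq y a b → ElℕEq x (code a) (code b)
    code-resp (inj₁ (inj₁ a)) (inj₁ (inj₁ b)) a≡b = inj₁-injective a≡b
    code-resp (inj₁ (inj₂ n)) (inj₁ (inj₂ m)) n≡m = cong (λ k → suc (2 * k)) (inj₂-injective n≡m)
    code-resp (inj₂ (inj₁ ν , S , inj₁ _)) (inj₂ (inj₁ ν' , S' , inj₁ _)) (ν≡ν' , e) =
      inj₁-injective ν≡ν' , trace-resp e
    code-resp (inj₂ (inj₁ ν , S , inj₁ (_ , o))) (inj₂ (inj₁ ν' , S' , inj₂ (_ , f))) (_ , e) =
      fan-not-old (≐-trans e f) o
    code-resp (inj₂ (inj₁ ν , S , inj₂ (_ , f))) (inj₂ (inj₁ ν' , S' , inj₁ (_ , o))) (_ , e) =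
      fan-not-old (≐-trans (≐-sym e) f) o
    code-resp (inj₂ (inj₁ ν , S , inj₂ _)) (inj₂ (inj₁ ν' , S' , inj₂ _)) _ = refl
    code-resp (inj₂ (inj₂ n , S , _)) (inj₂ (inj₂ m , S' , _)) (n≡m , _) =
      cong (λ k → 2 * suc k) (inj₂-injective n≡m)

    code-reflect : ∀ a b → ElℕEq x (code a) (code b) → ElEq y a b
    code-reflect (inj₁ (inj₁ a)) (inj₁ (inj₁ b)) a≡b = cong inj₁ a≡b
    code-reflect (inj₁ (inj₂ n)) (inj₁ (inj₂ m)) e =
      cong inj₂ (double-injective (suc-injective e))
    code-reflect (inj₁ (inj₂ n)) (inj₂ (inj₂ m , _)) e = even≢odd (suc m) n (sym e)
    code-reflect (inj₂ (inj₂ n , _)) (inj₁ (inj₂ m)) e = even≢odd (suc n) m e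
    code-reflect (inj₂ (inj₁ ν , S , inj₁ (_ , o))) (inj₂ (inj₁ ν' , S' , inj₁ (_ , o'))) (ν≡ν' , e) =
      cong inj₁ ν≡ν' , trace-injective o o' e
    code-reflect (inj₂ (inj₁ ν , S , inj₂ (ν≡η , f))) (inj₂ (inj₁ ν' , S' , inj₂ (ν'≡η , f'))) _ =
      cong inj₁ (trans ν≡η (sym ν'≡η)) , ≐-trans f (≐-sym f')
    code-reflect (inj₂ (inj₂ n , S , e)) (inj₂ (inj₂ m , S' , e')) c
      with double-injective {suc n} {suc m} c
    ... | refl = refl , ≐-trans e (≐-sym e')
    code-reflect (inj₁ (inj₁ a)) (inj₂ (inj₁ ν , S , inj₁ _)) ()
    code-reflect (inj₁ (inj₁ a)) (inj₂ (inj₁ ν , S , inj₂ _)) ()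
    code-reflect (inj₁ (inj₁ a)) (inj₂ (inj₂ n , _)) ()
    code-reflect (inj₁ (inj₂ n)) (inj₂ (inj₁ ν , S , inj₁ _)) ()
    code-reflect (inj₁ (inj₂ n)) (inj₂ (inj₁ ν , S , inj₂ _)) ()
    code-reflect (inj₂ (inj₁ ν , S , inj₁ _)) (inj₁ (inj₁ b)) ()
    code-reflect (inj₂ (inj₁ ν , S , inj₁ _)) (inj₁ (inj₂ m)) ()
    code-reflect (inj₂ (inj₁ ν , S , inj₂ _)) (inj₁ (inj₁ b)) ()
    code-reflect (inj₂ (inj₁ ν , S , inj₂ _)) (inj₁ (inj₂ m)) ()
    code-reflect (inj₂ (inj₂ n , _)) (inj₂ (inj₁ ν , S , inj₁ _)) ()
    code-reflect (inj₂ (inj₂ n , _)) (inj₂ (inj₁ ν , S , inj₂ _)) ()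

    norm-bound : NormLeNormPlusAleph0 y x
    norm-bound = code , code-resp , code-reflect

lemma2p2 : ExcludedMiddle 0ℓ → ExcludedMiddle (lsuc 0ℓ) →
    (x : K) (η : K.M x) → (∀ B → K.𝒜 x η B → B ≐ ｛ η ｝) →
    Σ K (λ y → Σ (x ≤K y) (λ e →
      MoreThanOne y (_≤K_.emb e η) × NormLeNormPlusAleph0 y x))
lemma2p2 em _ x η only-singleton = y , x≤y , two-families , norm-bound
  where
  open Extension.Build em x η only-singleton
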